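{- For all integers $k\ge 1$ and $b\ge 2$, there exists a factored graph representation of complexity $(b,k^2)$ for the decreasing path $\overleftarrow{\pi}_{b^k}:=([b^k-1]_b^k,\dots,[1]_b^k,[0]_b^k)$, i.e., the directed graph with vertex set $\mathbb{Z}_b^k$ and edges $([j+1]_b^k,[j]_b^k)$ for $0\le j<b^k-1$.
   Context: All graphs are directed. Graph operations: Cartesian product $G\,\square\,H$ (vertex set $V(G)\times V(H)$, edge $((v_1,u_1),(v_2,u_2))$ iff $v_1=v_2$ and $(u_1,u_2)\in E(H)$, or $u_1=u_2$ and $(v_1,v_2)\in E(G)$), tensor product $G\times H$ (vertex set $V(G)\times V(H)$, edge iff $(v_1,v_2)\in E(G)$ and $(u_1,u_2)\in E(H)$), and union $G\cup H$ (vertex set $V(G)\cup V(H)$, edge set $E(G)\cup E(H)$). Vertices of products are flattened tuples, so products are associative. A factored graph representation is a formula built from input graphs using these operations and parentheses; it has complexity $(n,k)$ if it uses $k-1$ operations on input graphs with at most $n$ vertices each. For $0\le j\le b^k-1$, $[j]_b^k=(b_{k-1},\dots,b_1,b_0)\in\mathbb{Z}_b^k$ denotes the $k$-digit base-$b$ expansion of $j$, i.e. $j=\sum_{i=0}^{k-1}b_ib^i$. -}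

module Defs where

open import Data.Nat using (ℕ; zero; suc; _+_; _*_; _^_; _≤_; _<_)
open import Data.List using (List; []; _∷_; [_]; _++_; length)
open import Data.List.Membership.Propositional using (_∈_)
open import Data.List.Relation.Unary.All using (All)
open import Data.Product using (Σ; _×_; _,_)
open import Data.Sum using (_⊎_)
open import Relation.Binary.PropositionalEquality using (_≡_)
open import Function.Bundles using (_⇔_)

-- Vertices of all graphs are flattened tuples: lists of atoms (natural numbers).
Vertex : Set
Vertex = List ℕ

record InputGraph : Set where
  constructor mkInput
  field
    verts : List ℕ
    edges : List (ℕ × ℕ)
open InputGraph public

data Formula : Set where
  leaf  : InputGraph → Formula
  _□_   : Formula → Formula → Formula
  _⊗_   : Formula → Formula → Formula
  _∪ᵍ_  : Formula → Formula → Formula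

ops : Formula → ℕ
ops (leaf _) = 0
ops (F □ H)  = suc (ops F + ops H)
ops (F ⊗ H)  = suc (ops F + ops H)
ops (F ∪ᵍ H) = suc (ops F + ops H)

InputsBounded : ℕ → Formula → Set
InputsBounded n (leaf G) = length (verts G) ≤ n
InputsBounded n (F □ H)  = InputsBounded n F × InputsBounded n H
InputsBounded n (F ⊗ H)  = InputsBounded n F × InputsBounded n H
InputsBounded n (F ∪ᵍ H) = InputsBounded n F × InputsBounded n H

HasComplexity : ℕ → ℕ → Formula → Set
HasComplexity n k F = InputsBounded n F × suc (ops F) ≡ k

Vert : Formula → Vertex → Set
Vert (leaf G) v = Σ ℕ λ a → v ≡ [ a ] × a ∈ verts G
Vert (F □ H)  v = Σ Vertex λ v₁ → Σ Vertex λ v₂ → v ≡ v₁ ++ v₂ × Vert F v₁ × Vert H v₂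
Vert (F ⊗ H)  v = Σ Vertex λ v₁ → Σ Vertex λ v₂ → v ≡ v₁ ++ v₂ × Vert F v₁ × Vert H v₂
Vert (F ∪ᵍ H) v = Vert F v ⊎ Vert H v

Edge : Formula → Vertex → Vertex → Set
Edge (leaf G) u w = Σ ℕ λ a → Σ ℕ λ c →
  u ≡ [ a ] × w ≡ [ c ] × (a , c) ∈ edges G × a ∈ verts G × c ∈ verts G
Edge (F □ H)  u w = Σ Vertex λ u₁ → Σ Vertex λ u₂ → Σ Vertex λ w₁ → Σ Vertex λ w₂ →
  u ≡ u₁ ++ u₂ × w ≡ w₁ ++ w₂ ×
  ((u₁ ≡ w₁ × Vert F u₁ × Edge H u₂ w₂) ⊎ (u₂ ≡ w₂ × Vert H u₂ × Edge F u₁ w₁))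
Edge (F ⊗ H)  u w = Σ Vertex λ u₁ → Σ Vertex λ u₂ → Σ Vertex λ w₁ → Σ Vertex λ w₂ →
  u ≡ u₁ ++ u₂ × w ≡ w₁ ++ w₂ × Edge F u₁ w₁ × Edge H u₂ w₂
Edge (F ∪ᵍ H) u w = Edge F u w ⊎ Edge H u w

value : ℕ → List ℕ → ℕ
value b []       = 0
value b (d ∷ ds) = d * b ^ length ds + value b ds

IsExpansion : ℕ → ℕ → ℕ → List ℕ → Set
IsExpansion b k j ds = length ds ≡ k × All (_< b) ds × value b ds ≡ j

PathVert : ℕ → ℕ → Vertex → Set
PathVert b k v = length v ≡ k × All (_< b) v

PathEdge : ℕ → ℕ → Vertex → Vertex → Set
PathEdge b k u w = Σ ℕ λ j → suc j < b ^ k × IsExpansion b k (suc j) u × IsExpansion b k j w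

RepresentsDecPath : ℕ → ℕ → Formula → Set
RepresentsDecPath b k F =
  (∀ v → Vert F v ⇔ PathVert b k v) × (∀ u w → Edge F u w ⇔ PathEdge b k u w)

{-# OPTIONS --safe #-}
-- Write numerals most significant digit first. The edge from j + 1 to j either keeps the
-- leading digit and decrements the tail, or turns a leading d + 1 into d while the tail
-- wraps from 0…0 to m…m (m = b − 1). Hence
--   π←(b^(k+1)) = (ℤ_b □ π←(b^k)) ∪ (π←(b) × C_k),
-- where C_k, the k-th tensor power of the one-edge graph 0 → m, has the single edge
-- 0…0 → m…m. Correctness reduces to uniqueness of base-b expansions: every numeral of
-- nonzero value has an explicit predecessor, and it is the only one.
module Submission where

open import Defs
open import Data.Nat using (ℕ; zero; suc; _+_; _*_; _^_; _≤_; _<_; z≤n; s≤s; z<s; _≟_; >-nonZero)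
open import Data.Nat.Properties
open import Data.Nat.DivMod using (_%_; m<n⇒m%n≡m; [m+kn]%n≡m%n)
open import Data.Nat.Tactic.RingSolver using (solve-∀)
open import Data.List using (List; []; _∷_; [_]; _++_; length; upTo; map; replicate)
open import Data.List.Properties using (length-upTo; length-replicate; length-++)
open import Data.List.Membership.Propositional.Properties using (∈-upTo⁺; ∈-upTo⁻; ∈-map⁺; ∈-map⁻)
open import Data.List.Relation.Unary.Any using (here; there)
open import Data.List.Relation.Unary.All using (All; []; _∷_)
open import Data.List.Relation.Unary.All.Properties using (++⁺; replicate⁺)
open import Data.Product using (Σ; ∃; _×_; _,_; proj₁; proj₂)
open import Data.Sum using (_⊎_; inj₁; inj₂; fromInj₂)
open import Data.Empty using (⊥-elim)
open import Function using (_∘_)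
open import Function.Bundles using (_⇔_; mk⇔; module Equivalence)
open import Function.Properties.Equivalence using () renaming (refl to ⇔-refl; trans to ⇔-trans)
open import Relation.Nullary using (¬_; yes; no)
open import Relation.Binary.PropositionalEquality hiding ([_])

open Equivalence using (to; from)

divMod-unique : ∀ {P x y r s} → r < P → s < P → x * P + r ≡ y * P + s → x ≡ y × r ≡ s
divMod-unique {P} {x} {y} {r} {s} r<P s<P eq = x≡y , r≡s
  where
    instance
      P≢0 = >-nonZero (≤-<-trans z≤n r<P)
    open ≡-Reasoning
    r≡s : r ≡ s
    r≡s = begin
      r               ≡⟨ m<n⇒m%n≡m r<P ⟨
      r % P           ≡⟨ [m+kn]%n≡m%n r x P ⟨
      (r + x * P) % P ≡⟨ cong (_% P) (trans (+-comm r _) (trans eq (+-comm _ s))) ⟩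
      (s + y * P) % P ≡⟨ [m+kn]%n≡m%n s y P ⟩
      s % P           ≡⟨ m<n⇒m%n≡m s<P ⟩
      s               ∎
    x≡y : x ≡ y
    x≡y = *-cancelʳ-≡ x y P (+-cancelʳ-≡ r _ _ (trans eq (cong (y * P +_) (sym r≡s))))

value-< : ∀ b ds → All (_< b) ds → value b ds < b ^ length ds
value-< b []       []              = z<s
value-< b (d ∷ ds) (d<b ∷ ds<b) = begin-strict
  d * P + value b ds <⟨ +-monoʳ-< (d * P) (value-< b ds ds<b) ⟩
  d * P + P          ≡⟨ +-comm (d * P) P ⟩
  suc d * P          ≤⟨ *-monoˡ-≤ P d<b ⟩
  b * P              ∎
  where
    P = b ^ length ds
    open ≤-Reasoning

value-injective : ∀ b {us ws} → length us ≡ length ws → All (_< b) us → All (_< b) ws →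
                  value b us ≡ value b ws → us ≡ ws
value-injective b {[]}     {[]}     _   _           _           _  = refl
value-injective b {x ∷ us} {y ∷ ws} len (_ ∷ us<b) (_ ∷ ws<b) eq =
  cong₂ _∷_ (proj₁ heads-tails) (value-injective b len′ us<b ws<b (proj₂ heads-tails))
  where
    len′ = suc-injective len
    ws<b^|us| : value b ws < b ^ length us
    ws<b^|us| = subst (λ L → value b ws < b ^ L) (sym len′) (value-< b ws ws<b)
    eq′ : x * b ^ length us + value b us ≡ y * b ^ length us + value b ws
    eq′ = subst (λ L → x * b ^ length us + value b us ≡ y * b ^ L + value b ws) (sym len′) eq
    heads-tails : x ≡ y × value b us ≡ value b ws
    heads-tails = divMod-unique (value-< b us us<b) ws<b^|us| eq′

value-replicate-0 : ∀ b n → value b (replicate n 0) ≡ 0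
value-replicate-0 b zero    = refl
value-replicate-0 b (suc n) = value-replicate-0 b n

value≡0⇒replicate-0 : ∀ b {n us} → 0 < b → length us ≡ n → All (_< b) us →
                      value b us ≡ 0 → us ≡ replicate n 0
value≡0⇒replicate-0 b {n} 0<b len us<b eq =
  value-injective b (trans len (sym (length-replicate n))) us<b (replicate⁺ n 0<b)
    (trans eq (sym (value-replicate-0 b n)))

value-replicate-max : ∀ m n → suc (value (suc m) (replicate n m)) ≡ suc m ^ n
value-replicate-max m zero    = refl
value-replicate-max m (suc n) rewrite length-replicate n {m} = begin
  suc (m * P + value (suc m) (replicate n m)) ≡⟨ +-suc (m * P) _ ⟨
  m * P + suc (value (suc m) (replicate n m)) ≡⟨ cong (m * P +_) (value-replicate-max m n) ⟩
  m * P + P                                   ≡⟨ +-comm (m * P) P ⟩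
  P + m * P                                   ∎
  where
    P = suc m ^ n
    open ≡-Reasoning

PathVert-++ : ∀ {b i j u v} → PathVert b i u → PathVert b j v → PathVert b (i + j) (u ++ v)
PathVert-++ {u = u} (refl , u<b) (refl , v<b) = length-++ u , ++⁺ u<b v<b

module Numerals (m : ℕ) where

  b : ℕ
  b = suc m

  data Successor : ℕ → List ℕ → List ℕ → Set where
    borrow : ∀ n {d} → d < m → Successor (suc n) (suc d ∷ replicate n 0) (d ∷ replicate n m)
    same   : ∀ {k x u w} → x < b → Successor k u w → Successor (suc k) (x ∷ u) (x ∷ w)

  Successor-digits : ∀ {k u w} → Successor k u w → PathVert b k u × PathVert b k w
  Successor-digits (borrow n d<m) =
    (cong suc (length-replicate n) , s≤s d<m ∷ replicate⁺ n z<s) ,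
    (cong suc (length-replicate n) , m<n⇒m<1+n d<m ∷ replicate⁺ n (n<1+n m))
  Successor-digits (same x<b s) =
    let (lu , u<b) , (lw , w<b) = Successor-digits s
    in (cong suc lu , x<b ∷ u<b) , (cong suc lw , x<b ∷ w<b)

  Successor-value : ∀ {k u w} → Successor k u w → value b u ≡ suc (value b w)
  Successor-value (borrow n {d} _) rewrite length-replicate n {0} | length-replicate n {m} = begin
    suc d * P + value b (replicate n 0) ≡⟨ cong (suc d * P +_) (value-replicate-0 b n) ⟩
    suc d * P + 0                       ≡⟨ +-identityʳ (suc d * P) ⟩
    P + d * P                           ≡⟨ +-comm P (d * P) ⟩
    d * P + P                           ≡⟨ cong (d * P +_) (value-replicate-max m n) ⟨
    d * P + suc (value b (replicate n m)) ≡⟨ +-suc (d * P) _ ⟩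
    suc (d * P + value b (replicate n m)) ∎
    where
      P = b ^ n
      open ≡-Reasoning
  Successor-value (same {x = x} {u} {w} _ s) = begin
    x * b ^ length u + value b u        ≡⟨ cong₂ (λ L v → x * b ^ L + v) |u|≡|w| (Successor-value s) ⟩
    x * b ^ length w + suc (value b w)  ≡⟨ +-suc _ _ ⟩
    suc (x * b ^ length w + value b w)  ∎
    where
      |u|≡|w| : length u ≡ length w
      |u|≡|w| = let (lu , _) , (lw , _) = Successor-digits s in trans lu (sym lw)
      open ≡-Reasoning

  predecessor : ∀ k u → PathVert b k u → value b u ≢ 0 → ∃ (Successor k u)
  predecessor zero    []       _                   u≢0 = ⊥-elim (u≢0 refl)
  predecessor (suc k) (x ∷ us) (len , x<b ∷ us<b) u≢0 with value b us ≟ 0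
  ... | no us≢0 =
    let w , s = predecessor k us (suc-injective len , us<b) us≢0 in x ∷ w , same x<b s
  ... | yes us≡0 with x | value≡0⇒replicate-0 b z<s (suc-injective len) us<b us≡0
  ...   | zero  | _    = ⊥-elim (u≢0 us≡0)
  ...   | suc d | refl = d ∷ replicate k m , borrow k (≤-pred x<b)

  Successor-complete : ∀ {k u w} → PathVert b k u → PathVert b k w →
                       value b u ≡ suc (value b w) → Successor k u w
  Successor-complete {k} {u} u-digits (lw , w<b) eq
    with w′ , s ← predecessor k u u-digits (λ u≡0 → 0≢1+n (trans (sym u≡0) eq))
    with lw′ , w′<b ← proj₂ (Successor-digits s)
    = subst (Successor k u) w′≡w s
    where
      w′≡w = value-injective b (trans lw′ (sym lw)) w′<b w<b
               (suc-injective (trans (sym (Successor-value s)) eq))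

  Successor⇔PathEdge : ∀ {k u w} → Successor k u w ⇔ PathEdge b k u w
  Successor⇔PathEdge {k} {u} {w} = mk⇔ toPathEdge fromPathEdge
    where
      toPathEdge : Successor k u w → PathEdge b k u w
      toPathEdge s =
        let (lu , u<b) , (lw , w<b) = Successor-digits s
            bound = subst₂ (λ v L → v < b ^ L) (Successor-value s) lu (value-< b u u<b)
        in value b w , bound , (lu , u<b , Successor-value s) , (lw , w<b , refl)
      fromPathEdge : PathEdge b k u w → Successor k u w
      fromPathEdge (_ , _ , (lu , u<b , eq) , (lw , w<b , refl)) =
        Successor-complete (lu , u<b) (lw , w<b) eq

empty : Formula
empty = leaf (mkInput [] [])

pad : ℕ → Formula → Formula
pad zero    F = F
pad (suc n) F = empty ∪ᵍ pad n F

⊎-dropˡ : ∀ {A B : Set} → ¬ A → (A ⊎ B) ⇔ B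
⊎-dropˡ ¬a = mk⇔ (fromInj₂ (⊥-elim ∘ ¬a)) inj₂

Vert-pad : ∀ n {F v} → Vert (pad n F) v ⇔ Vert F v
Vert-pad zero    = ⇔-refl
Vert-pad (suc n) = ⇔-trans (⊎-dropˡ λ { (_ , _ , ()) }) (Vert-pad n)

Edge-pad : ∀ n {F u w} → Edge (pad n F) u w ⇔ Edge F u w
Edge-pad zero    = ⇔-refl
Edge-pad (suc n) = ⇔-trans (⊎-dropˡ λ { (_ , _ , _ , _ , () , _) }) (Edge-pad n)

ops-pad : ∀ n F → ops (pad n F) ≡ n + ops F
ops-pad zero    F = refl
ops-pad (suc n) F = cong suc (ops-pad n F)

InputsBounded-pad : ∀ n {k F} → InputsBounded k F → InputsBounded k (pad n F)
InputsBounded-pad zero    bounded = bounded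
InputsBounded-pad (suc n) bounded = z≤n , InputsBounded-pad n bounded

module DecreasingPath (m : ℕ) where

  open Numerals m public

  digitGraph : List (ℕ × ℕ) → Formula
  digitGraph es = leaf (mkInput (upTo b) es)

  digitSteps : List (ℕ × ℕ)
  digitSteps = map (λ d → suc d , d) (upTo m)

  digits digitPath : Formula
  digits    = digitGraph []
  digitPath = digitGraph digitSteps

  wrapEdge : Formula
  wrapEdge = leaf (mkInput (0 ∷ m ∷ []) [ (0 , m) ])

  borrowEdge : ℕ → Formula
  borrowEdge zero    = wrapEdge
  borrowEdge (suc n) = wrapEdge ⊗ borrowEdge n

  prependDigit : ℕ → Formula → Formula
  prependDigit n F = (digits □ F) ∪ᵍ (digitPath ⊗ borrowEdge n)

  -- prependDigit n uses n + 3 operations; the n unions with the empty graph raise this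
  -- to 2n + 3 = (n + 2)² − (n + 1)².
  decPath : ℕ → Formula
  decPath zero    = digitPath
  decPath (suc n) = pad n (prependDigit n (decPath n))

  Vert-digitGraph : ∀ es {v} → Vert (digitGraph es) v ⇔ PathVert b 1 v
  Vert-digitGraph es {v} = mk⇔ toPathVert (fromPathVert v)
    where
      toPathVert : Vert (digitGraph es) v → PathVert b 1 v
      toPathVert (_ , refl , a∈) = refl , ∈-upTo⁻ a∈ ∷ []
      fromPathVert : ∀ v → PathVert b 1 v → Vert (digitGraph es) v
      fromPathVert (x ∷ []) (_ , x<b ∷ []) = x , refl , ∈-upTo⁺ x<b

  Edge-digitPath : ∀ {u w} → Edge digitPath u w ⇔ Successor 1 u w
  Edge-digitPath {u} {w} = mk⇔ toSuccessor fromSuccessor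
    where
      toSuccessor : Edge digitPath u w → Successor 1 u w
      toSuccessor (_ , _ , refl , refl , e∈ , _) with ∈-map⁻ _ e∈
      ... | d , d∈ , refl = borrow 0 (∈-upTo⁻ d∈)
      fromSuccessor : Successor 1 u w → Edge digitPath u w
      fromSuccessor (borrow 0 {d} d<m) =
        suc d , d , refl , refl , ∈-map⁺ _ (∈-upTo⁺ d<m) , ∈-upTo⁺ (s≤s d<m) , ∈-upTo⁺ (m<n⇒m<1+n d<m)

  Vert-wrapEdge⁻ : ∀ {v} → Vert wrapEdge v → PathVert b 1 v
  Vert-wrapEdge⁻ (_ , refl , here refl)         = refl , z<s ∷ []
  Vert-wrapEdge⁻ (_ , refl , there (here refl)) = refl , n<1+n m ∷ []

  Edge-wrapEdge⁻ : ∀ {u w} → Edge wrapEdge u w → u ≡ [ 0 ] × w ≡ [ m ]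
  Edge-wrapEdge⁻ (_ , _ , refl , refl , here refl , _) = refl , refl

  Edge-wrapEdge⁺ : Edge wrapEdge [ 0 ] [ m ]
  Edge-wrapEdge⁺ = 0 , m , refl , refl , here refl , here refl , there (here refl)

  Vert-borrowEdge⁻ : ∀ n {v} → Vert (borrowEdge n) v → PathVert b (suc n) v
  Vert-borrowEdge⁻ zero    v′ = Vert-wrapEdge⁻ v′
  Vert-borrowEdge⁻ (suc n) (_ , _ , refl , v₁ , v₂) =
    PathVert-++ (Vert-wrapEdge⁻ v₁) (Vert-borrowEdge⁻ n v₂)

  Edge-borrowEdge⁻ : ∀ n {u w} → Edge (borrowEdge n) u w →
                     u ≡ replicate (suc n) 0 × w ≡ replicate (suc n) m
  Edge-borrowEdge⁻ zero    e = Edge-wrapEdge⁻ e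
  Edge-borrowEdge⁻ (suc n) (_ , _ , _ , _ , refl , refl , e₁ , e₂)
    with refl , refl ← Edge-wrapEdge⁻ e₁
    with refl , refl ← Edge-borrowEdge⁻ n e₂
    = refl , refl

  Edge-borrowEdge⁺ : ∀ n → Edge (borrowEdge n) (replicate (suc n) 0) (replicate (suc n) m)
  Edge-borrowEdge⁺ zero    = Edge-wrapEdge⁺
  Edge-borrowEdge⁺ (suc n) =
    [ 0 ] , replicate (suc n) 0 , [ m ] , replicate (suc n) m , refl , refl ,
    Edge-wrapEdge⁺ , Edge-borrowEdge⁺ n

  Vert-prependDigit : ∀ n {F} → (∀ {v} → Vert F v ⇔ PathVert b (suc n) v) →
                      ∀ {v} → Vert (prependDigit n F) v ⇔ PathVert b (suc (suc n)) v
  Vert-prependDigit n {F} Vert-F {v} = mk⇔ toPathVert (fromPathVert v)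
    where
      toPathVert : Vert (prependDigit n F) v → PathVert b (suc (suc n)) v
      toPathVert (inj₁ (_ , _ , refl , v₁ , v₂)) =
        PathVert-++ (to (Vert-digitGraph []) v₁) (to Vert-F v₂)
      toPathVert (inj₂ (_ , _ , refl , v₁ , v₂)) =
        PathVert-++ (to (Vert-digitGraph digitSteps) v₁) (Vert-borrowEdge⁻ n v₂)
      fromPathVert : ∀ v → PathVert b (suc (suc n)) v → Vert (prependDigit n F) v
      fromPathVert (x ∷ v) (len , x<b ∷ v<b) =
        inj₁ ([ x ] , v , refl , from (Vert-digitGraph []) (refl , x<b ∷ []) ,
              from Vert-F (suc-injective len , v<b))

  Edge-prependDigit : ∀ n {F} → (∀ {u w} → Edge F u w ⇔ Successor (suc n) u w) →
                      ∀ {u w} → Edge (prependDigit n F) u w ⇔ Successor (suc (suc n)) u w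
  Edge-prependDigit n {F} Edge-F {u} {w} = mk⇔ toSuccessor fromSuccessor
    where
      toSuccessor : Edge (prependDigit n F) u w → Successor (suc (suc n)) u w
      toSuccessor (inj₁ (_ , _ , _ , _ , refl , refl , inj₁ (refl , (_ , refl , x∈) , e))) =
        same (∈-upTo⁻ x∈) (to Edge-F e)
      toSuccessor (inj₂ (_ , _ , _ , _ , refl , refl , e₁ , e₂))
        with borrow 0 d<m ← to Edge-digitPath e₁
        with refl , refl ← Edge-borrowEdge⁻ n e₂
        = borrow (suc n) d<m
      fromSuccessor : Successor (suc (suc n)) u w → Edge (prependDigit n F) u w
      fromSuccessor (same {x = x} {u′} {w′} x<b s) =
        inj₁ ([ x ] , u′ , [ x ] , w′ , refl , refl ,
              inj₁ (refl , (x , refl , ∈-upTo⁺ x<b) , from Edge-F s))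
      fromSuccessor (borrow _ {d} d<m) =
        inj₂ ([ suc d ] , replicate (suc n) 0 , [ d ] , replicate (suc n) m , refl , refl ,
              from Edge-digitPath (borrow 0 d<m) , Edge-borrowEdge⁺ n)

  Vert-decPath : ∀ n {v} → Vert (decPath n) v ⇔ PathVert b (suc n) v
  Vert-decPath zero    = Vert-digitGraph digitSteps
  Vert-decPath (suc n) = ⇔-trans (Vert-pad n) (Vert-prependDigit n (Vert-decPath n))

  Edge-decPath : ∀ n {u w} → Edge (decPath n) u w ⇔ Successor (suc n) u w
  Edge-decPath zero    = Edge-digitPath
  Edge-decPath (suc n) = ⇔-trans (Edge-pad n) (Edge-prependDigit n (Edge-decPath n))

  ops-borrowEdge : ∀ n → ops (borrowEdge n) ≡ n
  ops-borrowEdge zero    = refl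
  ops-borrowEdge (suc n) = cong suc (ops-borrowEdge n)

  ops-decPath : ∀ n → suc (ops (decPath n)) ≡ suc n * suc n
  ops-decPath zero    = refl
  ops-decPath (suc n) = begin
    suc (ops (pad n (prependDigit n (decPath n))))           ≡⟨ cong suc (ops-pad n _) ⟩
    suc (n + suc (suc (ops (decPath n)) + suc (ops (borrowEdge n))))
      ≡⟨ cong₂ (λ p c → suc (n + suc (p + suc c))) (ops-decPath n) (ops-borrowEdge n) ⟩
    suc (n + suc (suc n * suc n + suc n))                    ≡⟨ square-step n ⟩
    suc (suc n) * suc (suc n)                                ∎
    where
      square-step : ∀ n → suc (n + suc (suc n * suc n + suc n)) ≡ suc (suc n) * suc (suc n)
      square-step = solve-∀
      open ≡-Reasoning

  InputsBounded-digitGraph : ∀ es → InputsBounded b (digitGraph es)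
  InputsBounded-digitGraph _ = ≤-reflexive (length-upTo b)

  InputsBounded-borrowEdge : 1 ≤ m → ∀ n → InputsBounded b (borrowEdge n)
  InputsBounded-borrowEdge 1≤m zero    = s≤s 1≤m
  InputsBounded-borrowEdge 1≤m (suc n) = s≤s 1≤m , InputsBounded-borrowEdge 1≤m n

  InputsBounded-decPath : 1 ≤ m → ∀ n → InputsBounded b (decPath n)
  InputsBounded-decPath 1≤m zero    = InputsBounded-digitGraph digitSteps
  InputsBounded-decPath 1≤m (suc n) = InputsBounded-pad n
    ((InputsBounded-digitGraph [] , InputsBounded-decPath 1≤m n) ,
     (InputsBounded-digitGraph digitSteps , InputsBounded-borrowEdge 1≤m n))

corollary3p13 : (k b : ℕ) → 1 ≤ k → 2 ≤ b →
    Σ Formula λ F → HasComplexity b (k * k) F × RepresentsDecPath b k F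
corollary3p13 (suc n) (suc m) _ (s≤s 1≤m) =
  decPath n , (InputsBounded-decPath 1≤m n , ops-decPath n) ,
  (λ _ → Vert-decPath n) , (λ _ _ → ⇔-trans (Edge-decPath n) Successor⇔PathEdge)
  where open DecreasingPath m
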